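{- In the setting described in the context, the $R$-linear map $w':\mathfrak h\to\mathfrak h$ defined by $w'(\varphi)=\varphi\circ w^{ -1}$ for $\varphi\in\mathfrak a$ (so that $w'(\check\alpha)=(w\alpha)^\vee$) and $w'(X_{\widetilde\alpha})=X_{w\widetilde\alpha}$ for $\widetilde\alpha\in\widetilde\Phi$ preserves the Lie bracket: $[w'(x),w'(y)]=w'([x,y])$ for all $x,y\in\mathfrak h$. Consequently $\zeta_R\mapsto w'$ defines a homomorphism from $\mu_3(R)$ to the automorphism group of the Lie algebra $\mathfrak h$.
   Context: Let $R$ be a $\mathbb Z[1/210]$-algebra with $\operatorname{Spec}R$ connected, $\zeta_R\in R$ a fixed primitive cube root of unity. Let $\Lambda$ be an $E_8$ root lattice with roots $\Phi$ and pairing $(\cdot,\cdot)$, $w$ an automorphism of $\Lambda$ preserving the pairing, elliptic ($\Lambda^w=0$) of order 3, $\Lambda_w=\Lambda/(w-1)\Lambda$, $\langle\lambda,\mu\rangle=\zeta_R^{((1-w)\lambda,\mu)}$ on $\Lambda_w$. Let $\mathscr H$ be a central extension $1\to\mu_3(R)\to\mathscr H\to\Lambda_w\to1$ with $xyx^{ -1}y^{ -1}=\langle\bar x,\bar y\rangle$. Let $\widetilde\Lambda=\Lambda\times_{\Lambda_w}\mathscr H$, $\widetilde\Phi$ the preimage of $\Phi$, and extend $w$ to $\widetilde\Lambda$ by $w(\lambda,h)=(w\lambda,h)$. Let $\mathfrak a=\operatorname{Hom}(\Lambda,R)$, $\check\alpha=(\alpha,\cdot)$, $\mathfrak h_1$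 the quotient of the free $R$-module on $X_{\widetilde\alpha}$ ($\widetilde\alpha\in\widetilde\Phi$) by $X_{\zeta_R\widetilde\alpha}=\zeta_RX_{\widetilde\alpha}$, and $\mathfrak h=\mathfrak a\oplus\mathfrak h_1$ with the Lie bracket: $[\mathfrak a,\mathfrak a]=0$; $[\check\alpha,X_{\widetilde\beta}]=-[X_{\widetilde\beta},\check\alpha]=(\alpha,\beta)X_{\widetilde\beta}$; $[X_{\widetilde\alpha},X_{\widetilde\beta}]=-\widetilde\alpha\widetilde\beta\check\alpha$ if $\alpha+\beta=0$, $(-1)^{(\alpha,w\beta)}\langle\alpha,\beta\rangle X_{\widetilde\alpha\widetilde\beta}$ if $\alpha+\beta\in\Phi$, $0$ otherwise (here $\alpha,\beta$ denote images in $\Lambda$). -}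

module Defs where

open import Level using (Level; _⊔_) renaming (suc to lsuc)
open import Data.Nat using (ℕ; zero; suc)
open import Data.Integer as ℤ using (ℤ; +_; -[1+_]; 0ℤ; 1ℤ; _%ℕ_)
open import Data.Integer.Tactic.RingSolver using (solve-∀)
open import Data.Fin as Fin using (Fin)
open import Data.Bool using (if_then_else_)
open import Data.Vec as Vec using (Vec; []; _∷_; zipWith; replicate; tabulate; lookup)
open import Data.Vec.Properties using (≡-dec)
open import Data.List as List using (List; []; _∷_; _++_; [_])
open import Data.Product using (Σ; _×_; _,_; proj₁; proj₂)
open import Data.Sum using (_⊎_)
open import Relation.Nullary using (¬_; yes; no)
open import Relation.Nullary.Decidable using (⌊_⌋)
open import Relation.Binary.PropositionalEquality
  using (_≡_; refl; sym; trans; cong; cong₂; subst; module ≡-Reasoning)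
open import Algebra.Bundles using (CommutativeRing; Group; Semiring)
import Algebra.Definitions.RawSemiring as RawSemiringDefs

-- The E8 root lattice Λ = ℤ^8, coordinates w.r.t. the simple roots
-- (Bourbaki labelling: edges 1-3, 3-4, 4-5, 5-6, 6-7, 7-8, 2-4).

Λ : Set
Λ = Vec ℤ 8

infixl 6 _⊕_ _⊝_

_⊕_ : ∀ {n} → Vec ℤ n → Vec ℤ n → Vec ℤ n
_⊕_ = zipWith ℤ._+_

_⊝_ : ∀ {n} → Vec ℤ n → Vec ℤ n → Vec ℤ n
_⊝_ = zipWith ℤ._-_

0Λ : Λ
0Λ = replicate 8 0ℤ

dot : ∀ {n} → Vec ℤ n → Vec ℤ n → ℤ
dot []       []       = 0ℤ
dot (a ∷ as) (b ∷ bs) = a ℤ.* b ℤ.+ dot as bs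

private
  o t m : ℤ
  o = + 0
  t = + 2
  m = -[1+ 0 ]

-- Cartan (= Gram) matrix of E8
E8-Cartan : Vec (Vec ℤ 8) 8
E8-Cartan =
    (t ∷ o ∷ m ∷ o ∷ o ∷ o ∷ o ∷ o ∷ [])
  ∷ (o ∷ t ∷ o ∷ m ∷ o ∷ o ∷ o ∷ o ∷ [])
  ∷ (m ∷ o ∷ t ∷ m ∷ o ∷ o ∷ o ∷ o ∷ [])
  ∷ (o ∷ m ∷ m ∷ t ∷ m ∷ o ∷ o ∷ o ∷ [])
  ∷ (o ∷ o ∷ o ∷ m ∷ t ∷ m ∷ o ∷ o ∷ [])
  ∷ (o ∷ o ∷ o ∷ o ∷ m ∷ t ∷ m ∷ o ∷ [])
  ∷ (o ∷ o ∷ o ∷ o ∷ o ∷ m ∷ t ∷ m ∷ [])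
  ∷ (o ∷ o ∷ o ∷ o ∷ o ∷ o ∷ m ∷ t ∷ [])
  ∷ []

⟪_,_⟫ : Λ → Λ → ℤ
⟪ l , l' ⟫ = dot l (Vec.map (λ row → dot row l') E8-Cartan)

e : Fin 8 → Λ
e i = tabulate (λ j → if ⌊ i Fin.≟ j ⌋ then 1ℤ else 0ℤ)

IsRoot : Λ → Set
IsRoot l = ⟪ l , l ⟫ ≡ + 2

castℤ : ∀ {c ℓ} (R : CommutativeRing c ℓ) → ℤ → CommutativeRing.Carrier R
castℤ R (+ n)    = n ·ℕ 1#
  where open CommutativeRing R
        open RawSemiringDefs (Semiring.rawSemiring semiring) renaming (_×_ to _·ℕ_)
castℤ R -[1+ n ] = - (suc n ·ℕ 1#)
  where open CommutativeRing R
        open RawSemiringDefs (Semiring.rawSemiring semiring) renaming (_×_ to _·ℕ_)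

record Setting (c ℓ h ℓh : Level) : Set (lsuc (c ⊔ ℓ ⊔ h ⊔ ℓh)) where
  field
    R : CommutativeRing c ℓ
  open CommutativeRing R renaming (Carrier to |R|; _≈_ to _≈R_)
  open RawSemiringDefs (Semiring.rawSemiring semiring) using (_^_)

  ℤ→R : ℤ → |R|
  ℤ→R = castℤ R

  field
    -- R is a ℤ[1/210]-algebra
    210-invertible : Σ |R| (λ u → ℤ→R (+ 210) * u ≈R 1#)
    -- Spec R is connected (nonempty, no nontrivial idempotents)
    nontrivial : ¬ (1# ≈R 0#)
    connected : ∀ x → x * x ≈R x → (x ≈R 0#) ⊎ (x ≈R 1#)
    ζ : |R|
    ζ-cube : ζ ^ 3 ≈R 1#
    ζ-primitive : 1# + ζ + ζ ^ 2 ≈R 0#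
    w : Λ → Λ
    w-additive : ∀ l l' → w (l ⊕ l') ≡ w l ⊕ w l'
    w-isometry : ∀ l l' → ⟪ w l , w l' ⟫ ≡ ⟪ l , l' ⟫
    w-order3 : ∀ l → w (w (w l)) ≡ l
    w-nontrivial : ¬ (∀ l → w l ≡ l)
    w-elliptic : ∀ l → w l ≡ l → l ≡ 0Λ

  -- l ∼ l'  iff  l and l' have the same image in Λ_w = Λ/(w-1)Λ,
  -- i.e. l - l' = ν - w ν for some ν
  infix 4 _∼_
  _∼_ : Λ → Λ → Set
  l ∼ l' = Σ Λ (λ ν → l ⊕ w ν ≡ l' ⊕ ν)

  μ₃ : Set (c ⊔ ℓ)
  μ₃ = Σ |R| (λ z → z ^ 3 ≈R 1#)

  ⟨_,_⟩ : Λ → Λ → |R|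
  ⟨ l , l' ⟩ = ζ ^ (⟪ l ⊝ w l , l' ⟫ %ℕ 3)

  field
    -- the central extension 1 → μ₃(R) → H → Λ_w → 1
    H : Group h ℓh
  open Group H renaming (Carrier to |H|; _≈_ to _≈H_; _∙_ to _·_; _⁻¹ to inv)
  field
    π : |H| → Λ        -- a lift of the projection H → Λ_w
    π-cong : ∀ {x y} → x ≈H y → π x ∼ π y
    π-hom : ∀ x y → π x ⊕ π y ∼ π (x · y)
    π-surjective : ∀ l → Σ |H| (λ x → l ∼ π x)
    ι : μ₃ → |H|
    ι-cong : ∀ {z z'} → proj₁ z ≈R proj₁ z' → ι z ≈H ι z'
    ι-hom : ∀ z z' z'' → proj₁ z'' ≈R proj₁ z * proj₁ z' → ι z'' ≈H ι z · ι z'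
    ι-injective : ∀ z z' → ι z ≈H ι z' → proj₁ z ≈R proj₁ z'
    ι-in-kernel : ∀ z → 0Λ ∼ π (ι z)
    kernel-in-ι : ∀ x → 0Λ ∼ π x → Σ μ₃ (λ z → ι z ≈H x)
    ι-central : ∀ z x → ι z · x ≈H x · ι z
    commutator : ∀ x y (z : μ₃) → proj₁ z ≈R ⟨ π x , π y ⟩ →
                 ((x · y) · inv x) · inv y ≈H ι z

private
  module V where
    R1z : ∀ a b c d f → (a ℤ.+ b) ℤ.+ ((c ℤ.+ d) ℤ.+ f) ≡ ((a ℤ.+ c) ℤ.+ (b ℤ.+ d)) ℤ.+ f
    R1z = solve-∀
    R2z : ∀ a b c d f → ((a ℤ.+ b) ℤ.+ (c ℤ.+ d)) ℤ.+ f ≡ ((a ℤ.+ c) ℤ.+ f) ℤ.+ (b ℤ.+ d)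
    R2z = solve-∀
    R3z : ∀ a b f → (a ℤ.+ b) ℤ.+ f ≡ a ℤ.+ (f ℤ.+ b)
    R3z = solve-∀
    R4z : ∀ a b f d → a ℤ.+ ((b ℤ.+ f) ℤ.+ d) ≡ (d ℤ.+ b) ℤ.+ (a ℤ.+ f)
    R4z = solve-∀
    R5z : ∀ a b f d → (a ℤ.+ b) ℤ.+ (f ℤ.+ d) ≡ a ℤ.+ ((b ℤ.+ f) ℤ.+ d)
    R5z = solve-∀

  R1 : ∀ {n} (a b c d f : Vec ℤ n) → (a ⊕ b) ⊕ ((c ⊕ d) ⊕ f) ≡ ((a ⊕ c) ⊕ (b ⊕ d)) ⊕ f
  R1 [] [] [] [] [] = refl
  R1 (a ∷ as) (b ∷ bs) (c ∷ cs) (d ∷ ds) (f ∷ fs) = cong₂ _∷_ (V.R1z a b c d f) (R1 as bs cs ds fs)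

  R2 : ∀ {n} (a b c d f : Vec ℤ n) → ((a ⊕ b) ⊕ (c ⊕ d)) ⊕ f ≡ ((a ⊕ c) ⊕ f) ⊕ (b ⊕ d)
  R2 [] [] [] [] [] = refl
  R2 (a ∷ as) (b ∷ bs) (c ∷ cs) (d ∷ ds) (f ∷ fs) = cong₂ _∷_ (V.R2z a b c d f) (R2 as bs cs ds fs)

  R3 : ∀ {n} (a b f : Vec ℤ n) → (a ⊕ b) ⊕ f ≡ a ⊕ (f ⊕ b)
  R3 [] [] [] = refl
  R3 (a ∷ as) (b ∷ bs) (f ∷ fs) = cong₂ _∷_ (V.R3z a b f) (R3 as bs fs)

  R4 : ∀ {n} (a b f d : Vec ℤ n) → a ⊕ ((b ⊕ f) ⊕ d) ≡ (d ⊕ b) ⊕ (a ⊕ f)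
  R4 [] [] [] [] = refl
  R4 (a ∷ as) (b ∷ bs) (f ∷ fs) (d ∷ ds) = cong₂ _∷_ (V.R4z a b f d) (R4 as bs fs ds)

  R5 : ∀ {n} (a b f d : Vec ℤ n) → (a ⊕ b) ⊕ (f ⊕ d) ≡ a ⊕ ((b ⊕ f) ⊕ d)
  R5 [] [] [] [] = refl
  R5 (a ∷ as) (b ∷ bs) (f ∷ fs) (d ∷ ds) = cong₂ _∷_ (V.R5z a b f d) (R5 as bs fs ds)

module Construction {c ℓ h ℓh} (S : Setting c ℓ h ℓh) where
  open Setting S public
  open CommutativeRing R public using (_+_; _*_; -_; 0#; 1#)
    renaming (Carrier to |R|; _≈_ to _≈R_)
  open RawSemiringDefs (Semiring.rawSemiring (CommutativeRing.semiring R)) public using (_^_)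
  open Group H public using ()
    renaming (Carrier to |H|; _≈_ to _≈H_; _∙_ to _·_)

  L1 : ∀ {α β x y} → α ∼ π x → β ∼ π y → α ⊕ β ∼ π (x · y)
  L1 {α} {β} {x} {y} (ν₁ , e₁) (ν₂ , e₂) with π-hom x y
  ... | ν₃ , e₃ = (ν₁ ⊕ ν₂) ⊕ ν₃ , (begin
      (α ⊕ β) ⊕ w ((ν₁ ⊕ ν₂) ⊕ ν₃)
        ≡⟨ cong ((α ⊕ β) ⊕_) (trans (w-additive _ _) (cong (_⊕ w ν₃) (w-additive _ _))) ⟩
      (α ⊕ β) ⊕ ((w ν₁ ⊕ w ν₂) ⊕ w ν₃)
        ≡⟨ R1 α β (w ν₁) (w ν₂) (w ν₃) ⟩
      ((α ⊕ w ν₁) ⊕ (β ⊕ w ν₂)) ⊕ w ν₃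
        ≡⟨ cong (_⊕ w ν₃) (cong₂ _⊕_ e₁ e₂) ⟩
      ((π x ⊕ ν₁) ⊕ (π y ⊕ ν₂)) ⊕ w ν₃
        ≡⟨ R2 (π x) ν₁ (π y) ν₂ (w ν₃) ⟩
      ((π x ⊕ π y) ⊕ w ν₃) ⊕ (ν₁ ⊕ ν₂)
        ≡⟨ cong (_⊕ (ν₁ ⊕ ν₂)) e₃ ⟩
      (π (x · y) ⊕ ν₃) ⊕ (ν₁ ⊕ ν₂)
        ≡⟨ R3 (π (x · y)) ν₃ (ν₁ ⊕ ν₂) ⟩
      π (x · y) ⊕ ((ν₁ ⊕ ν₂) ⊕ ν₃) ∎)
    where open ≡-Reasoning

  L2 : ∀ {α x} → α ∼ π x → w α ∼ π x
  L2 {α} {x} (ν , e₁) = (ν ⊕ w α) ⊕ w (w α) , (begin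
      w α ⊕ w ((ν ⊕ w α) ⊕ w (w α))
        ≡⟨ cong (w α ⊕_) (trans (w-additive _ _) (cong₂ _⊕_ (w-additive _ _) (w-order3 α))) ⟩
      w α ⊕ ((w ν ⊕ w (w α)) ⊕ α)
        ≡⟨ R4 (w α) (w ν) (w (w α)) α ⟩
      (α ⊕ w ν) ⊕ (w α ⊕ w (w α))
        ≡⟨ cong (_⊕ (w α ⊕ w (w α))) e₁ ⟩
      (π x ⊕ ν) ⊕ (w α ⊕ w (w α))
        ≡⟨ R5 (π x) ν (w α) (w (w α)) ⟩
      π x ⊕ ((ν ⊕ w α) ⊕ w (w α)) ∎)
    where open ≡-Reasoning

  -- Φ̃ : pairs (α, x) ∈ Λ ×_{Λ_w} H with α a root
  Φ̃ : Set h
  Φ̃ = Σ Λ (λ α → Σ |H| (λ x → IsRoot α × α ∼ π x))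

  _≐_ : Φ̃ → Φ̃ → Set ℓh
  (α , x , _) ≐ (β , y , _) = α ≡ β × x ≈H y

  -- formal R-linear combinations of the symbols X_α̃
  FS : Set (c ⊔ h)
  FS = List (|R| × Φ̃)

  -- the equality of 𝔥₁: free R-module on Φ̃ modulo X_{ζα̃} = ζ X_α̃
  infix 4 _≋_
  data _≋_ : FS → FS → Set (c ⊔ ℓ ⊔ h ⊔ ℓh) where
    ≋-refl  : ∀ {s} → s ≋ s
    ≋-sym   : ∀ {s t} → s ≋ t → t ≋ s
    ≋-trans : ∀ {s t u} → s ≋ t → t ≋ u → s ≋ u
    ≋-++    : ∀ {s s' t t'} → s ≋ s' → t ≋ t' → s ++ t ≋ s' ++ t'
    ≋-comm  : ∀ s t → s ++ t ≋ t ++ s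
    ≋-coeff : ∀ {r r' b b'} → r ≈R r' → b ≐ b' → [ (r , b) ] ≋ [ (r' , b') ]
    ≋-merge : ∀ r r' b → (r , b) ∷ (r' , b) ∷ [] ≋ [ (r + r' , b) ]
    ≋-zero  : ∀ b → [ (0# , b) ] ≋ []
    ≋-ζ     : ∀ r α x y p q (z : μ₃) → proj₁ z ≈R ζ → y ≈H ι z · x →
              [ (r , (α , y , q)) ] ≋ [ (r * ζ , (α , x , p)) ]

  -- 𝔞 = Hom(Λ, R), an element being given by its values on the basis e
  𝔞 : Set c
  𝔞 = Fin 8 → |R|

  0𝔞 : 𝔞
  0𝔞 _ = 0#

  _+𝔞_ : 𝔞 → 𝔞 → 𝔞
  (φ +𝔞 ψ) i = φ i + ψ i

  sumFin : ∀ {n} → (Fin n → |R|) → |R|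
  sumFin {zero}  f = 0#
  sumFin {suc n} f = f Fin.zero + sumFin (λ i → f (Fin.suc i))

  eval : 𝔞 → Λ → |R|
  eval φ l = sumFin (λ i → ℤ→R (lookup l i) * φ i)

  coroot : Λ → 𝔞
  coroot α i = ℤ→R ⟪ α , e i ⟫

  sign : ℤ → |R|
  sign k = (- 1#) ^ (k %ℕ 2)

  𝔥 : Set (c ⊔ h)
  𝔥 = 𝔞 × FS

  infix 4 _≈𝔥_
  _≈𝔥_ : 𝔥 → 𝔥 → Set (c ⊔ ℓ ⊔ h ⊔ ℓh)
  (φ , s) ≈𝔥 (ψ , t) = (∀ i → φ i ≈R ψ i) × s ≋ t

  bracketX : |R| × Φ̃ → |R| × Φ̃ → 𝔥
  bracketX (r , (α , x , rα , pα)) (r' , (β , y , rβ , pβ))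
    with ≡-dec ℤ._≟_ (α ⊕ β) 0Λ
  ... | yes eq = (λ i → - (r * r' * proj₁ (proj₁ (kernel-in-ι (x · y) (subst (_∼ π (x · y)) eq (L1 pα pβ))))) * coroot α i) , []
  ... | no _ with ⟪ α ⊕ β , α ⊕ β ⟫ ℤ.≟ + 2
  ...   | yes root = 0𝔞 , [ (r * r' * (sign ⟪ α , w β ⟫ * ⟨ α , β ⟩) , (α ⊕ β , x · y , root , L1 pα pβ)) ]
  ...   | no _ = 0𝔞 , []

  ⟦_,_⟧ : 𝔥 → 𝔥 → 𝔥
  ⟦ (φ , s) , (ψ , t) ⟧ =
      List.foldr (λ u acc → proj₁ u +𝔞 acc) 0𝔞 pairs
    , (List.map (λ { (r' , b) → (eval φ (proj₁ b) * r' , b) }) t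
       ++ List.map (λ { (r , b) → (- (eval ψ (proj₁ b) * r) , b) }) s
       ++ List.concatMap proj₂ pairs)
    where
      pairs : List 𝔥
      pairs = List.concatMap (λ u → List.map (bracketX u) t) s

  -- w′(φ) = φ ∘ w⁻¹ (w⁻¹ = w ∘ w), w′(X_α̃) = X_{wα̃}
  wX : |R| × Φ̃ → |R| × Φ̃
  wX (r , (α , x , rα , p)) = r , (w α , x , trans (w-isometry α α) rα , L2 p)

  w′ : 𝔥 → 𝔥
  w′ (φ , s) = (λ i → eval φ (w (w (e i)))) , List.map wX s

  iter : (𝔥 → 𝔥) → ℕ → 𝔥 → 𝔥
  iter f zero    x = x
  iter f (suc k) x = f (iter f k x)

-- w permutes the roots and preserves ( , ), hence also ⟨ , ⟩ and the sign (-1)^(α, wβ); so it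
-- sends every defining case of [X_α̃ , X_β̃] to the same case for wα̃, wβ̃. On 𝔞, an additive map
-- ℤ⁸ → R is determined by its values on the simple roots, which gives eval (w′φ) λ = φ (w⁻¹ λ),
-- w′ α̌ = (wα)ˇ and [w′φ , w′X] = w′[φ , X]; bilinearity extends all of this to the whole bracket.
-- Finally w³ = 1 gives w′³ = 1; and 3 divides the unit 210 of R, so 3 ≠ 0, hence 1 + ζ + ζ² = 0
-- excludes ζ = 1 and ζ^k = ζ^m forces k ≡ m (mod 3).
{-# OPTIONS --safe #-}
module Submission where

open import Defs
open import Level using (_⊔_)
open import Data.Nat as ℕ using (ℕ; zero; suc; _<_; _%_; s≤s)
open import Data.Nat.DivMod using (m%n<n)
import Data.Nat.Properties as ℕ
open import Data.Integer as ℤ using (ℤ; +_; -[1+_]; 0ℤ; 1ℤ; _⊖_)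
import Data.Integer.Properties as ℤ
open import Data.Integer.Tactic.RingSolver using (solve-∀)
open import Data.Fin as Fin using (Fin)
open import Data.Bool using (if_then_else_)
open import Data.Vec as Vec using (Vec; []; _∷_; replicate; tabulate; lookup)
open import Data.Vec.Properties
  using (≡-dec; ∷-injective; tabulate-cong; lookup-zipWith; lookup-replicate; zipWith-identityˡ)
open import Data.List as List using (List; []; _∷_; _++_)
open import Data.List.Properties using (map-++)
open import Data.List.Relation.Binary.Pointwise as Pointwise using (Pointwise; []; _∷_)
open import Data.Product using (_×_; _,_; proj₁; proj₂)
open import Relation.Nullary using (¬_; yes; no; contradiction)
open import Relation.Nullary.Decidable using (⌊_⌋; ⌊⌋-map′)
open import Algebra.Bundles using (CommutativeRing; Group)
open import Algebra.Properties.Ring ℤ.+-*-ring using () renaming (x+x≈x⇒x≈0 to i+i≡i⇒i≡0)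
import Relation.Binary.PropositionalEquality as ≡
open ≡ using (_≡_; cong; cong₂; subst)

tabulate-const : ∀ {a} {A : Set a} n (x : A) → tabulate {n = n} (λ _ → x) ≡ replicate n x
tabulate-const zero    x = ≡.refl
tabulate-const (suc n) x = cong (x ∷_) (tabulate-const n x)

⊝-⊕-cancel : ∀ {n} (a b : Vec ℤ n) → (a ⊝ b) ⊕ b ≡ a
⊝-⊕-cancel []       []       = ≡.refl
⊝-⊕-cancel (a ∷ as) (b ∷ bs) = cong₂ _∷_ (cancel a b) (⊝-⊕-cancel as bs)
  where cancel : ∀ a b → (a ℤ.- b) ℤ.+ b ≡ a
        cancel = solve-∀

⊕-⊝-cancel : ∀ {n} (a b : Vec ℤ n) → (a ⊕ b) ⊝ b ≡ a
⊕-⊝-cancel []       []       = ≡.refl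
⊕-⊝-cancel (a ∷ as) (b ∷ bs) = cong₂ _∷_ (cancel a b) (⊕-⊝-cancel as bs)
  where cancel : ∀ a b → (a ℤ.+ b) ℤ.- b ≡ a
        cancel = solve-∀

x⊕y≡z⇒x≡z⊝y : ∀ {n} {x y z : Vec ℤ n} → x ⊕ y ≡ z → x ≡ z ⊝ y
x⊕y≡z⇒x≡z⊝y {x = x} {y} ≡.refl = ≡.sym (⊕-⊝-cancel x y)

x≡x⊕x⇒x≡0 : ∀ {n} (x : Vec ℤ n) → x ≡ x ⊕ x → x ≡ replicate n 0ℤ
x≡x⊕x⇒x≡0 []       _ = ≡.refl
x≡x⊕x⇒x≡0 (a ∷ as) p with ∷-injective p
... | a≡a+a , as≡as⊕as = cong₂ _∷_ (i+i≡i⇒i≡0 a (≡.sym a≡a+a)) (x≡x⊕x⇒x≡0 as as≡as⊕as)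

dot-distribˡ-⊕ : ∀ {n} (u a b : Vec ℤ n) → dot u (a ⊕ b) ≡ dot u a ℤ.+ dot u b
dot-distribˡ-⊕ []       []       []       = ≡.refl
dot-distribˡ-⊕ (u ∷ us) (a ∷ as) (b ∷ bs) =
  ≡.trans (cong (λ t → u ℤ.* (a ℤ.+ b) ℤ.+ t) (dot-distribˡ-⊕ us as bs)) (regroup u a b _ _)
  where regroup : ∀ u a b s t →
                  u ℤ.* (a ℤ.+ b) ℤ.+ (s ℤ.+ t) ≡ (u ℤ.* a ℤ.+ s) ℤ.+ (u ℤ.* b ℤ.+ t)
        regroup = solve-∀

map-dot-distrib-⊕ : ∀ {m n} (rows : Vec (Vec ℤ n) m) a b →
  Vec.map (λ row → dot row (a ⊕ b)) rows
    ≡ Vec.map (λ row → dot row a) rows ⊕ Vec.map (λ row → dot row b) rows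
map-dot-distrib-⊕ []       a b = ≡.refl
map-dot-distrib-⊕ (r ∷ rs) a b = cong₂ _∷_ (dot-distribˡ-⊕ r a b) (map-dot-distrib-⊕ rs a b)

⟪⟫-distribˡ-⊕ : ∀ α a b → ⟪ α , a ⊕ b ⟫ ≡ ⟪ α , a ⟫ ℤ.+ ⟪ α , b ⟫
⟪⟫-distribˡ-⊕ α a b =
  ≡.trans (cong (dot α) (map-dot-distrib-⊕ E8-Cartan a b)) (dot-distribˡ-⊕ α _ _)

basis : ∀ {n} → Fin n → Vec ℤ n
basis i = tabulate (λ j → if ⌊ i Fin.≟ j ⌋ then 1ℤ else 0ℤ)

basis-suc : ∀ {n} (i : Fin n) → basis (Fin.suc i) ≡ 0ℤ ∷ basis i
basis-suc i =
  cong (0ℤ ∷_) (tabulate-cong λ j → cong (λ b → if b then 1ℤ else 0ℤ) (⌊⌋-map′ _ _ (i Fin.≟ j)))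

module IntegerLinearForms {c ℓ} (R : CommutativeRing c ℓ) where
  open CommutativeRing R
  open import Algebra.Properties.Semiring.Sum semiring
    using (sum; sum-cong-≋; ∑-distrib-+; *-distribˡ-sum; sum-replicate-zero)
  open import Algebra.Properties.Semiring.Mult semiring using (×-homo-+)
    renaming (_×_ to _·_)
  open import Algebra.Properties.Ring ring
    using (-0#≈0#; -‿+-comm; x+x≈x⇒x≈0; +-inverseˡ-unique; -‿distribˡ-*)
  open import Algebra.Properties.CommutativeSemigroup +-commutativeSemigroup using (interchange)
  open import Algebra.Properties.CommutativeSemigroup *-commutativeSemigroup using (x∙yz≈y∙xz)
  open import Relation.Binary.Reasoning.Setoid setoid

  castℤ-⊖ : ∀ m n → castℤ R (m ⊖ n) ≈ m · 1# - n · 1#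
  castℤ-⊖ m       zero    = sym (trans (+-congˡ -0#≈0#) (+-identityʳ _))
  castℤ-⊖ zero    (suc n) = sym (+-identityˡ _)
  castℤ-⊖ (suc m) (suc n) = begin
    castℤ R (suc m ⊖ suc n)              ≡⟨ cong (castℤ R) (ℤ.[1+m]⊖[1+n]≡m⊖n m n) ⟩
    castℤ R (m ⊖ n)                      ≈⟨ castℤ-⊖ m n ⟩
    m · 1# - n · 1#                      ≈⟨ +-identityˡ _ ⟨
    0# + (m · 1# - n · 1#)               ≈⟨ +-congʳ (-‿inverseʳ 1#) ⟨
    (1# - 1#) + (m · 1# - n · 1#)        ≈⟨ interchange _ _ _ _ ⟩
    (1# + m · 1#) + (- 1# + - (n · 1#))  ≈⟨ +-congˡ (-‿+-comm 1# (n · 1#)) ⟩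
    suc m · 1# - suc n · 1#              ∎

  castℤ-homo-+ : ∀ i j → castℤ R (i ℤ.+ j) ≈ castℤ R i + castℤ R j
  castℤ-homo-+ (+ m)    (+ n)    = ×-homo-+ 1# m n
  castℤ-homo-+ (+ m)    -[1+ n ] = castℤ-⊖ m (suc n)
  castℤ-homo-+ -[1+ m ] (+ n)    = trans (castℤ-⊖ n (suc m)) (+-comm _ _)
  castℤ-homo-+ -[1+ m ] -[1+ n ] = begin
    - (suc (suc (m ℕ.+ n)) · 1#)     ≡⟨ cong (λ k → - (suc k · 1#)) (ℕ.+-suc m n) ⟨
    - ((suc m ℕ.+ suc n) · 1#)       ≈⟨ -‿cong (×-homo-+ 1# (suc m) (suc n)) ⟩
    - (suc m · 1# + suc n · 1#)      ≈⟨ -‿+-comm _ _ ⟨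
    - (suc m · 1#) + - (suc n · 1#)  ∎

  additive⇒scaling : (f : ℤ → Carrier) → (∀ i j → f (i ℤ.+ j) ≈ f i + f j) →
                     ∀ k → f k ≈ castℤ R k * f 1ℤ
  additive⇒scaling f f-+ = scaling
    where
      f0≈0 : f 0ℤ ≈ 0#
      f0≈0 = x+x≈x⇒x≈0 _ (sym (f-+ 0ℤ 0ℤ))

      scaling-ℕ : ∀ n → f (+ n) ≈ n · 1# * f 1ℤ
      scaling-ℕ zero    = trans f0≈0 (sym (zeroˡ _))
      scaling-ℕ (suc n) = begin
        f (+ suc n)                ≈⟨ f-+ 1ℤ (+ n) ⟩
        f 1ℤ + f (+ n)             ≈⟨ +-cong (sym (*-identityˡ _)) (scaling-ℕ n) ⟩
        1# * f 1ℤ + n · 1# * f 1ℤ  ≈⟨ distribʳ _ _ _ ⟨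
        suc n · 1# * f 1ℤ          ∎

      scaling : ∀ k → f k ≈ castℤ R k * f 1ℤ
      scaling (+ n)    = scaling-ℕ n
      scaling -[1+ n ] = begin
        f -[1+ n ]                 ≈⟨ +-inverseˡ-unique _ _ f[-n]+f[n]≈0 ⟩
        - f (+ suc n)              ≈⟨ -‿cong (scaling-ℕ (suc n)) ⟩
        - (suc n · 1# * f 1ℤ)      ≈⟨ -‿distribˡ-* _ _ ⟩
        castℤ R -[1+ n ] * f 1ℤ    ∎
        where f[-n]+f[n]≈0 : f -[1+ n ] + f (+ suc n) ≈ 0#
              f[-n]+f[n]≈0 = trans (sym (f-+ -[1+ n ] (+ suc n)))
                                   (trans (reflexive (cong f (ℤ.n⊖n≡0 (suc n)))) f0≈0)

  eval : ∀ {n} → (Fin n → Carrier) → Vec ℤ n → Carrier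
  eval φ l = sum (λ i → castℤ R (lookup l i) * φ i)

  eval-cong : ∀ {n} {φ ψ : Fin n → Carrier} → (∀ i → φ i ≈ ψ i) → ∀ l → eval φ l ≈ eval ψ l
  eval-cong φ≈ψ l = sum-cong-≋ (λ i → *-congˡ (φ≈ψ i))

  eval-+ : ∀ {n} (φ ψ : Fin n → Carrier) l → eval (λ i → φ i + ψ i) l ≈ eval φ l + eval ψ l
  eval-+ {n} φ ψ l = begin
    eval (λ i → φ i + ψ i) l
      ≈⟨ sum-cong-≋ {n} (λ i → distribˡ _ _ _) ⟩
    sum (λ i → castℤ R (lookup l i) * φ i + castℤ R (lookup l i) * ψ i)
      ≈⟨ ∑-distrib-+ (λ i → castℤ R (lookup l i) * φ i) _ ⟩
    eval φ l + eval ψ l ∎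

  eval-* : ∀ {n} k (φ : Fin n → Carrier) l → eval (λ i → k * φ i) l ≈ k * eval φ l
  eval-* {n} k φ l = begin
    eval (λ i → k * φ i) l                        ≈⟨ sum-cong-≋ {n} (λ i → x∙yz≈y∙xz _ k _) ⟩
    sum (λ i → k * (castℤ R (lookup l i) * φ i))  ≈⟨ *-distribˡ-sum {n} k _ ⟨
    k * eval φ l                                  ∎

  eval-0 : ∀ {n} (l : Vec ℤ n) → eval (λ _ → 0#) l ≈ 0#
  eval-0 {n} l = begin
    eval (λ _ → 0#) l   ≈⟨ sum-cong-≋ {n} (λ i → zeroʳ _) ⟩
    sum {n} (λ _ → 0#)  ≈⟨ sum-replicate-zero n ⟩
    0#                  ∎

  eval-0ᵛ : ∀ {n} (φ : Fin n → Carrier) → eval φ (replicate n 0ℤ) ≈ 0#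
  eval-0ᵛ {n} φ = begin
    eval φ (replicate n 0ℤ)  ≈⟨ sum-cong-≋ {n} (λ i → trans (*-congʳ (castℤ-lookup-0 i)) (zeroˡ (φ i))) ⟩
    sum {n} (λ _ → 0#)       ≈⟨ sum-replicate-zero n ⟩
    0#                       ∎
    where castℤ-lookup-0 : ∀ i → castℤ R (lookup (replicate n 0ℤ) i) ≈ 0#
          castℤ-lookup-0 i = reflexive (cong (castℤ R) (lookup-replicate i 0ℤ))

  eval-⊕ : ∀ {n} (φ : Fin n → Carrier) a b → eval φ (a ⊕ b) ≈ eval φ a + eval φ b
  eval-⊕ {n} φ a b = begin
    eval φ (a ⊕ b)
      ≈⟨ sum-cong-≋ {n} (λ i → trans (*-congʳ (castℤ-lookup-⊕ i)) (distribʳ _ _ _)) ⟩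
    sum (λ i → castℤ R (lookup a i) * φ i + castℤ R (lookup b i) * φ i)
      ≈⟨ ∑-distrib-+ (λ i → castℤ R (lookup a i) * φ i) _ ⟩
    eval φ a + eval φ b ∎
    where castℤ-lookup-⊕ : ∀ i → castℤ R (lookup (a ⊕ b) i)
                                 ≈ castℤ R (lookup a i) + castℤ R (lookup b i)
          castℤ-lookup-⊕ i = trans (reflexive (cong (castℤ R) (lookup-zipWith ℤ._+_ i a b)))
                                   (castℤ-homo-+ (lookup a i) (lookup b i))

  eval-basis : ∀ {n} (φ : Fin n → Carrier) i → eval φ (basis i) ≈ φ i
  eval-basis {suc n} φ Fin.zero = begin
    (1# + 0#) * φ Fin.zero + eval (λ i → φ (Fin.suc i)) (tabulate (λ _ → 0ℤ))
      ≡⟨ cong (λ z → (1# + 0#) * φ Fin.zero + eval (λ i → φ (Fin.suc i)) z) (tabulate-const n 0ℤ) ⟩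
    (1# + 0#) * φ Fin.zero + eval (λ i → φ (Fin.suc i)) (replicate n 0ℤ)
      ≈⟨ +-cong (trans (*-congʳ (+-identityʳ 1#)) (*-identityˡ _)) (eval-0ᵛ {n} _) ⟩
    φ Fin.zero + 0#
      ≈⟨ +-identityʳ _ ⟩
    φ Fin.zero ∎
  eval-basis {suc n} φ (Fin.suc i) = begin
    eval φ (basis (Fin.suc i))                              ≡⟨ cong (eval φ) (basis-suc i) ⟩
    0# * φ Fin.zero + eval (λ j → φ (Fin.suc j)) (basis i)  ≈⟨ +-cong (zeroˡ _) (eval-basis _ i) ⟩
    0# + φ (Fin.suc i)                                      ≈⟨ +-identityˡ _ ⟩
    φ (Fin.suc i)                                           ∎

  additive⇒eval-basis : ∀ {n} (g : Vec ℤ n → Carrier) → (∀ a b → g (a ⊕ b) ≈ g a + g b) →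
                        ∀ l → g l ≈ eval (λ i → g (basis i)) l
  additive⇒eval-basis g g-⊕ [] = x+x≈x⇒x≈0 _ (sym (g-⊕ [] []))
  additive⇒eval-basis {suc n} g g-⊕ (a ∷ l) = begin
    g (a ∷ l)
      ≡⟨ cong g (cong₂ _∷_ (ℤ.+-identityʳ a) (0ᵛ-⊕ l)) ⟨
    g ((a ∷ 0ᵛ) ⊕ (0ℤ ∷ l))
      ≈⟨ g-⊕ _ _ ⟩
    g (a ∷ 0ᵛ) + g (0ℤ ∷ l)
      ≈⟨ +-cong (additive⇒scaling (λ k → g (k ∷ 0ᵛ)) head-additive a)
                (additive⇒eval-basis (λ v → g (0ℤ ∷ v)) (λ u v → g-⊕ (0ℤ ∷ u) (0ℤ ∷ v)) l) ⟩
    castℤ R a * g (1ℤ ∷ 0ᵛ) + eval (λ i → g (0ℤ ∷ basis i)) l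
      ≈⟨ +-cong (*-congˡ (reflexive (cong (λ z → g (1ℤ ∷ z)) (≡.sym (tabulate-const n 0ℤ)))))
                (eval-cong (λ i → reflexive (cong g (≡.sym (basis-suc i)))) l) ⟩
    eval (λ i → g (basis i)) (a ∷ l) ∎
    where
      0ᵛ = replicate n 0ℤ
      0ᵛ-⊕ : ∀ l → 0ᵛ ⊕ l ≡ l
      0ᵛ-⊕ = zipWith-identityˡ ℤ.+-identityˡ
      head-additive : ∀ i j → g ((i ℤ.+ j) ∷ 0ᵛ) ≈ g (i ∷ 0ᵛ) + g (j ∷ 0ᵛ)
      head-additive i j =
        trans (reflexive (cong (λ z → g ((i ℤ.+ j) ∷ z)) (≡.sym (0ᵛ-⊕ 0ᵛ)))) (g-⊕ _ _)

module CubeRoots {c ℓ} (R : CommutativeRing c ℓ) where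
  open CommutativeRing R
  open import Algebra.Properties.Semiring.Mult semiring using (×1-homo-*)
    renaming (_×_ to _·_)
  open import Algebra.Properties.Semiring.Exp semiring using (_^_; ^-homo-*)
  open import Relation.Binary.Reasoning.Setoid setoid

  ·1#-factor-of-unit≉0 : ∀ m n {u} → (m ℕ.* n) · 1# * u ≈ 1# → ¬ 1# ≈ 0# → ¬ m · 1# ≈ 0#
  ·1#-factor-of-unit≉0 m n {u} mn·u≈1 1≉0 m·1≈0 = 1≉0 (begin
    1#                   ≈⟨ mn·u≈1 ⟨
    (m ℕ.* n) · 1# * u   ≈⟨ *-congʳ (×1-homo-* m n) ⟩
    m · 1# * n · 1# * u  ≈⟨ *-congʳ (*-congʳ m·1≈0) ⟩
    0# * n · 1# * u      ≈⟨ *-congʳ (zeroˡ _) ⟩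
    0# * u               ≈⟨ zeroˡ u ⟩
    0#                   ∎)

  ^-%3 : ∀ {z} → z ^ 3 ≈ 1# → ∀ k → z ^ k ≈ z ^ (k % 3)
  ^-%3 z³≈1 0 = refl
  ^-%3 z³≈1 1 = refl
  ^-%3 z³≈1 2 = refl
  ^-%3 {z} z³≈1 (suc (suc (suc k))) = begin
    z ^ (3 ℕ.+ k)  ≈⟨ ^-homo-* z 3 k ⟩
    z ^ 3 * z ^ k  ≈⟨ *-congʳ z³≈1 ⟩
    1# * z ^ k     ≈⟨ *-identityˡ _ ⟩
    z ^ k          ≈⟨ ^-%3 z³≈1 k ⟩
    z ^ (k % 3)    ∎

  module PrimitiveCubeRoot {z} (z³≈1 : z ^ 3 ≈ 1#) (1+z+z²≈0 : 1# + z + z ^ 2 ≈ 0#)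
                           (3≉0 : ¬ 3 · 1# ≈ 0#) where

    z¹≉z⁰ : ¬ z ^ 1 ≈ z ^ 0
    z¹≉z⁰ z¹≈1 = 3≉0 (begin
      1# + (1# + (1# + 0#))  ≈⟨ +-congˡ (+-congˡ (+-identityʳ 1#)) ⟩
      1# + (1# + 1#)         ≈⟨ +-assoc _ _ _ ⟨
      1# + 1# + 1#           ≈⟨ +-cong (+-congˡ z≈1) z²≈1 ⟨
      1# + z + z ^ 2         ≈⟨ 1+z+z²≈0 ⟩
      0#                     ∎)
      where z≈1  = trans (sym (*-identityʳ z)) z¹≈1
            z²≈1 = trans (*-cong z≈1 z¹≈1) (*-identityˡ 1#)

    z²≉z⁰ : ¬ z ^ 2 ≈ z ^ 0
    z²≉z⁰ z²≈1 = z¹≉z⁰ (trans (*-congˡ (sym z²≈1)) z³≈1)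

    z¹≉z² : ¬ z ^ 1 ≈ z ^ 2
    z¹≉z² z¹≈z² = z²≉z⁰ (trans (*-congˡ z¹≈z²) z³≈1)

    ^-injective-<3 : ∀ {i j} → i < 3 → j < 3 → z ^ i ≈ z ^ j → i ≡ j
    ^-injective-<3 {0} {0} _ _ _ = ≡.refl
    ^-injective-<3 {0} {1} _ _ p = contradiction (sym p) z¹≉z⁰
    ^-injective-<3 {0} {2} _ _ p = contradiction (sym p) z²≉z⁰
    ^-injective-<3 {1} {0} _ _ p = contradiction p z¹≉z⁰
    ^-injective-<3 {1} {1} _ _ _ = ≡.refl
    ^-injective-<3 {1} {2} _ _ p = contradiction p z¹≉z²
    ^-injective-<3 {2} {0} _ _ p = contradiction p z²≉z⁰
    ^-injective-<3 {2} {1} _ _ p = contradiction (sym p) z¹≉z²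
    ^-injective-<3 {2} {2} _ _ _ = ≡.refl
    ^-injective-<3 {suc (suc (suc _))} (s≤s (s≤s (s≤s ()))) _ _
    ^-injective-<3 {_} {suc (suc (suc _))} _ (s≤s (s≤s (s≤s ()))) _

module W′-Automorphism {c ℓ h ℓh} (S : Setting c ℓ h ℓh) where
  -- At n = 8, `IntegerLinearForms.eval` unfolds to `Construction.eval`.
  open Construction S hiding (eval)
  open IntegerLinearForms R
  open CubeRoots R
  private
    module ℛ = CommutativeRing R
    module ℋ = Group H
  open import Relation.Binary.Reasoning.Setoid ℛ.setoid

  w-0 : w 0Λ ≡ 0Λ
  w-0 = x≡x⊕x⇒x≡0 (w 0Λ) (w-additive 0Λ 0Λ)  -- 0Λ ⊕ 0Λ reduces to 0Λ

  w-⊝ : ∀ a b → w (a ⊝ b) ≡ w a ⊝ w b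
  w-⊝ a b = x⊕y≡z⇒x≡z⊝y (≡.trans (≡.sym (w-additive (a ⊝ b) b)) (cong w (⊝-⊕-cancel a b)))

  w-injective : ∀ {a b} → w a ≡ w b → a ≡ b
  w-injective {a} {b} wa≡wb =
    ≡.trans (≡.sym (w-order3 a)) (≡.trans (cong (λ v → w (w v)) wa≡wb) (w-order3 b))

  w-⊕≡0 : ∀ {α β} → α ⊕ β ≡ 0Λ → w α ⊕ w β ≡ 0Λ
  w-⊕≡0 {α} {β} α+β≡0 = ≡.trans (≡.sym (w-additive α β)) (≡.trans (cong w α+β≡0) w-0)

  w-⊕≡0⁻¹ : ∀ {α β} → w α ⊕ w β ≡ 0Λ → α ⊕ β ≡ 0Λ
  w-⊕≡0⁻¹ {α} {β} wα+wβ≡0 =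
    w-injective (≡.trans (w-additive α β) (≡.trans wα+wβ≡0 (≡.sym w-0)))

  ⟪⟫-⊕-w : ∀ α β → ⟪ w α ⊕ w β , w α ⊕ w β ⟫ ≡ ⟪ α ⊕ β , α ⊕ β ⟫
  ⟪⟫-⊕-w α β = ≡.trans (cong (λ v → ⟪ v , v ⟫) (≡.sym (w-additive α β))) (w-isometry _ _)

  ⟨⟩-w : ∀ α β → ⟨ w α , w β ⟩ ≡ ⟨ α , β ⟩
  ⟨⟩-w α β = cong (λ k → ζ ^ (k ℤ.%ℕ 3))
    (≡.trans (cong (λ v → ⟪ v , w β ⟫) (≡.sym (w-⊝ α (w α)))) (w-isometry _ _))

  w′𝔞 : 𝔞 → 𝔞
  w′𝔞 φ i = eval φ (w (w (e i)))

  eval-w′𝔞 : ∀ φ l → eval (w′𝔞 φ) l ≈R eval φ (w (w l))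
  eval-w′𝔞 φ l = ℛ.sym (additive⇒eval-basis (λ v → eval φ (w (w v))) ww-additive l)
    where ww-additive : ∀ a b → eval φ (w (w (a ⊕ b))) ≈R eval φ (w (w a)) + eval φ (w (w b))
          ww-additive a b =
            ℛ.trans (ℛ.reflexive (cong (eval φ) (≡.trans (cong w (w-additive a b)) (w-additive _ _))))
                    (eval-⊕ φ (w (w a)) (w (w b)))

  eval-w′𝔞-w : ∀ φ l → eval (w′𝔞 φ) (w l) ≈R eval φ l
  eval-w′𝔞-w φ l = ℛ.trans (eval-w′𝔞 φ (w l)) (ℛ.reflexive (cong (eval φ) (w-order3 l)))

  eval-coroot : ∀ α l → eval (coroot α) l ≈R ℤ→R ⟪ α , l ⟫
  eval-coroot α l = ℛ.sym (additive⇒eval-basis (λ v → ℤ→R ⟪ α , v ⟫) pairing-additive l)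
    where pairing-additive : ∀ a b → ℤ→R ⟪ α , a ⊕ b ⟫ ≈R ℤ→R ⟪ α , a ⟫ + ℤ→R ⟪ α , b ⟫
          pairing-additive a b = ℛ.trans (ℛ.reflexive (cong ℤ→R (⟪⟫-distribˡ-⊕ α a b)))
                                         (castℤ-homo-+ ⟪ α , a ⟫ ⟪ α , b ⟫)

  w′𝔞-coroot : ∀ α i → w′𝔞 (coroot α) i ≈R coroot (w α) i
  w′𝔞-coroot α i = ℛ.trans (eval-coroot α (w (w (e i)))) (ℛ.reflexive (cong ℤ→R pairing-w))
    where pairing-w : ⟪ α , w (w (e i)) ⟫ ≡ ⟪ w α , e i ⟫
          pairing-w = ≡.trans (≡.sym (w-isometry α (w (w (e i)))))
                              (cong (λ v → ⟪ w α , v ⟫) (w-order3 (e i)))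

  kernel-in-ι-irrelevant : ∀ {x} (p q : 0Λ ∼ π x) →
                           proj₁ (proj₁ (kernel-in-ι x p)) ≈R proj₁ (proj₁ (kernel-in-ι x q))
  kernel-in-ι-irrelevant {x} p q =
    ι-injective _ _ (ℋ.trans (proj₂ (kernel-in-ι x p)) (ℋ.sym (proj₂ (kernel-in-ι x q))))

  bracketX-wX : ∀ u v → bracketX (wX u) (wX v) ≈𝔥 w′ (bracketX u v)
  bracketX-wX (r , (α , x , _ , pα)) (r' , (β , y , _ , pβ))
    with ≡-dec ℤ._≟_ (α ⊕ β) 0Λ | ≡-dec ℤ._≟_ (w α ⊕ w β) 0Λ
  ... | yes α+β≡0 | no wα+wβ≢0  = contradiction (w-⊕≡0 α+β≡0) wα+wβ≢0
  ... | no α+β≢0  | yes wα+wβ≡0 = contradiction (w-⊕≡0⁻¹ wα+wβ≡0) α+β≢0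
  ... | yes α+β≡0 | yes wα+wβ≡0 = (λ i → begin
          - (r * r' * k′) * coroot (w α) i
            ≈⟨ ℛ.*-cong (ℛ.-‿cong (ℛ.*-congˡ k′≈k)) (ℛ.sym (w′𝔞-coroot α i)) ⟩
          - (r * r' * k) * w′𝔞 (coroot α) i
            ≈⟨ eval-* _ (coroot α) (w (w (e i))) ⟨
          w′𝔞 (λ j → - (r * r' * k) * coroot α j) i ∎)
      , ≋-refl
    where
      k  = proj₁ (proj₁ (kernel-in-ι (x · y) (subst (_∼ π (x · y)) α+β≡0 (L1 pα pβ))))
      k′ = proj₁ (proj₁ (kernel-in-ι (x · y) (subst (_∼ π (x · y)) wα+wβ≡0 (L1 (L2 pα) (L2 pβ)))))
      k′≈k : k′ ≈R k
      k′≈k = kernel-in-ι-irrelevant _ _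
  ... | no _ | no _ with ⟪ α ⊕ β , α ⊕ β ⟫ ℤ.≟ + 2 | ⟪ w α ⊕ w β , w α ⊕ w β ⟫ ℤ.≟ + 2
  ...   | yes root | no ¬wroot = contradiction (≡.trans (⟪⟫-⊕-w α β) root) ¬wroot
  ...   | no ¬root | yes wroot = contradiction (≡.trans (≡.sym (⟪⟫-⊕-w α β)) wroot) ¬root
  ...   | no _     | no _      = (λ i → ℛ.sym (eval-0 (w (w (e i))))) , ≋-refl
  ...   | yes _    | yes _     = (λ i → ℛ.sym (eval-0 (w (w (e i)))))
                                 , ≋-coeff (ℛ.reflexive (cong (r * r' *_) structure-constant))
                                           (≡.sym (w-additive α β) , ℋ.refl)
    where
      structure-constant : sign ⟪ w α , w (w β) ⟫ * ⟨ w α , w β ⟩ ≡ sign ⟪ α , w β ⟫ * ⟨ α , β ⟩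
      structure-constant = cong₂ _*_ (cong sign (w-isometry α (w β))) (⟨⟩-w α β)

  Term : Set (c ⊔ h)
  Term = |R| × Φ̃

  ≡⇒≋ : ∀ {s t : FS} → s ≡ t → s ≋ t
  ≡⇒≋ ≡.refl = ≋-refl

  map-wX-++ : ∀ s t → List.map wX (s ++ t) ≋ List.map wX s ++ List.map wX t
  map-wX-++ s t = ≡⇒≋ (map-++ wX s t)

  map-wX-≋ : ∀ {s t} → s ≋ t → List.map wX s ≋ List.map wX t
  map-wX-≋ ≋-refl              = ≋-refl
  map-wX-≋ (≋-sym s≋t)         = ≋-sym (map-wX-≋ s≋t)
  map-wX-≋ (≋-trans s≋t t≋u)   = ≋-trans (map-wX-≋ s≋t) (map-wX-≋ t≋u)
  map-wX-≋ (≋-++ {s} {s'} {t} {t'} s≋s' t≋t') =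
    ≋-trans (map-wX-++ s t)
            (≋-trans (≋-++ (map-wX-≋ s≋s') (map-wX-≋ t≋t')) (≋-sym (map-wX-++ s' t')))
  map-wX-≋ (≋-comm s t) =
    ≋-trans (map-wX-++ s t)
            (≋-trans (≋-comm (List.map wX s) (List.map wX t)) (≋-sym (map-wX-++ t s)))
  map-wX-≋ (≋-coeff r≈r' (α≡β , x≈y)) = ≋-coeff r≈r' (cong w α≡β , x≈y)
  map-wX-≋ (≋-merge r r' b)           = ≋-merge r r' (proj₂ (wX (r , b)))
  map-wX-≋ (≋-zero b)                 = ≋-zero (proj₂ (wX (0# , b)))
  map-wX-≋ (≋-ζ r α x y p q z z≈ζ y≈zx) = ≋-ζ r (w α) x y (w-lift p) (w-lift q) z z≈ζ y≈zx
    where w-lift : ∀ {α x} → IsRoot α × α ∼ π x → IsRoot (w α) × w α ∼ π x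
          w-lift (root , α∼x) = ≡.trans (w-isometry _ _) root , L2 α∼x

  w′-cong : ∀ x y → x ≈𝔥 y → w′ x ≈𝔥 w′ y
  w′-cong (φ , s) (ψ , t) (φ≈ψ , s≋t) = (λ i → eval-cong φ≈ψ (w (w (e i)))) , map-wX-≋ s≋t

  -- The terms [φ , r X_β̃] (g = id) and [r X_α̃ , ψ] (g = -_) of ⟦_,_⟧; written with
  -- projections so that they agree definitionally with the pattern lambdas there.
  scale : (|R| → |R|) → 𝔞 → Term → Term
  scale g φ u = g (eval φ (proj₁ (proj₂ u)) * proj₁ u) , proj₂ u

  map-scale-wX : ∀ g → (∀ {a b} → a ≈R b → g a ≈R g b) → ∀ φ t →
                 List.map (scale g (w′𝔞 φ)) (List.map wX t) ≋ List.map wX (List.map (scale g φ) t)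
  map-scale-wX g g-cong φ []      = ≋-refl
  map-scale-wX g g-cong φ (u ∷ t) =
    ≋-++ (≋-coeff (g-cong (ℛ.*-congʳ (eval-w′𝔞-w φ _))) (≡.refl , ℋ.refl))
         (map-scale-wX g g-cong φ t)

  Pointwise-map-wX : ∀ {r} {P : Term → Term → Set r} → (∀ u → P (wX u) u) →
                     ∀ t → Pointwise P (List.map wX t) t
  Pointwise-map-wX P-wX []      = []
  Pointwise-map-wX P-wX (u ∷ t) = P-wX u ∷ Pointwise-map-wX P-wX t

  _≈w′_ : 𝔥 → 𝔥 → Set (c ⊔ ℓ ⊔ h ⊔ ℓh)
  x′ ≈w′ x = x′ ≈𝔥 w′ x

  pairs : FS → FS → List 𝔥
  pairs s t = List.concatMap (λ u → List.map (bracketX u) t) s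

  𝔞-part : List 𝔥 → 𝔞
  𝔞-part = List.foldr (λ u acc → proj₁ u +𝔞 acc) 0𝔞

  𝔥₁-part : List 𝔥 → FS
  𝔥₁-part = List.concatMap proj₂

  pairs-w′ : ∀ s t → Pointwise _≈w′_ (pairs (List.map wX s) (List.map wX t)) (pairs s t)
  pairs-w′ s t = Pointwise.concat⁺ (Pointwise.map⁺ _ _ (Pointwise-map-wX row s))
    where row : ∀ u → Pointwise _≈w′_ (List.map (bracketX (wX u)) (List.map wX t))
                                      (List.map (bracketX u) t)
          row u = Pointwise.map⁺ _ _ (Pointwise-map-wX (bracketX-wX u) t)

  𝔞-part-w′ : ∀ {L′ L} → Pointwise _≈w′_ L′ L → ∀ i → 𝔞-part L′ i ≈R w′𝔞 (𝔞-part L) i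
  𝔞-part-w′ [] i = ℛ.sym (eval-0 (w (w (e i))))
  𝔞-part-w′ {_ ∷ _} {x ∷ L} (x′≈w′x ∷ L′≈w′L) i =
    ℛ.trans (ℛ.+-cong (proj₁ x′≈w′x i) (𝔞-part-w′ L′≈w′L i))
            (ℛ.sym (eval-+ (proj₁ x) (𝔞-part L) (w (w (e i)))))

  𝔥₁-part-w′ : ∀ {L′ L} → Pointwise _≈w′_ L′ L → 𝔥₁-part L′ ≋ List.map wX (𝔥₁-part L)
  𝔥₁-part-w′ [] = ≋-refl
  𝔥₁-part-w′ {_ ∷ _} {x ∷ L} (x′≈w′x ∷ L′≈w′L) =
    ≋-trans (≋-++ (proj₂ x′≈w′x) (𝔥₁-part-w′ L′≈w′L)) (≋-sym (map-wX-++ (proj₂ x) _))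

  ⟦⟧-w′ : ∀ x y → ⟦ w′ x , w′ y ⟧ ≈𝔥 w′ ⟦ x , y ⟧
  ⟦⟧-w′ (φ , s) (ψ , t) = 𝔞-part-w′ pairs≈ , ≋-trans (≋-++ A≈ (≋-++ B≈ C≈)) (≋-sym w′[A++B++C])
    where
      pairs≈ = pairs-w′ s t
      A = List.map (scale (λ a → a) φ) t
      B = List.map (scale -_ ψ) s
      C = 𝔥₁-part (pairs s t)
      A≈ = map-scale-wX (λ a → a) (λ a≈b → a≈b) φ t
      B≈ = map-scale-wX -_ ℛ.-‿cong ψ s
      C≈ = 𝔥₁-part-w′ pairs≈
      w′[A++B++C] : List.map wX (A ++ B ++ C) ≋ List.map wX A ++ List.map wX B ++ List.map wX C
      w′[A++B++C] = ≋-trans (map-wX-++ A (B ++ C)) (≋-++ ≋-refl (map-wX-++ B C))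

  ≈𝔥-refl : ∀ {x} → x ≈𝔥 x
  ≈𝔥-refl = (λ i → ℛ.refl) , ≋-refl

  ≈𝔥-sym : ∀ {x y} → x ≈𝔥 y → y ≈𝔥 x
  ≈𝔥-sym (φ≈ψ , s≋t) = (λ i → ℛ.sym (φ≈ψ i)) , ≋-sym s≋t

  ≈𝔥-trans : ∀ {x y z} → x ≈𝔥 y → y ≈𝔥 z → x ≈𝔥 z
  ≈𝔥-trans (φ≈ψ , s≋t) (ψ≈χ , t≋u) = (λ i → ℛ.trans (φ≈ψ i) (ψ≈χ i)) , ≋-trans s≋t t≋u

  map-wX³ : ∀ s → List.map wX (List.map wX (List.map wX s)) ≋ s
  map-wX³ []      = ≋-refl
  map-wX³ (u ∷ s) = ≋-++ (≋-coeff ℛ.refl (w-order3 _ , ℋ.refl)) (map-wX³ s)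

  w′³≈id : ∀ x → w′ (w′ (w′ x)) ≈𝔥 x
  w′³≈id (φ , s) = (λ i → begin
      eval (w′𝔞 (w′𝔞 φ)) (w (w (e i)))    ≈⟨ eval-w′𝔞 (w′𝔞 φ) (w (w (e i))) ⟩
      eval (w′𝔞 φ) (w (w (w (w (e i)))))  ≡⟨ cong (eval (w′𝔞 φ)) (w-order3 (w (e i))) ⟩
      eval (w′𝔞 φ) (w (e i))              ≈⟨ eval-w′𝔞-w φ (e i) ⟩
      eval φ (e i)                        ≈⟨ eval-basis φ i ⟩
      φ i                                 ∎)
    , map-wX³ s

  iter-%3 : ∀ {f} → (∀ x → f (f (f x)) ≈𝔥 x) → ∀ k x → iter f k x ≈𝔥 iter f (k % 3) x
  iter-%3 f³≈id 0 x = ≈𝔥-refl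
  iter-%3 f³≈id 1 x = ≈𝔥-refl
  iter-%3 f³≈id 2 x = ≈𝔥-refl
  iter-%3 {f} f³≈id (suc (suc (suc k))) x = ≈𝔥-trans (f³≈id (iter f k x)) (iter-%3 f³≈id k x)

  open PrimitiveCubeRoot ζ-cube ζ-primitive
         (·1#-factor-of-unit≉0 3 70 (proj₂ 210-invertible) nontrivial)

  ζ^≈⇒iter-w′≈ : ∀ (k m : ℕ) x → ζ ^ k ≈R ζ ^ m → iter w′ k x ≈𝔥 iter w′ m x
  ζ^≈⇒iter-w′≈ k m x ζᵏ≈ζᵐ =
    ≈𝔥-trans (iter-%3 w′³≈id k x)
             (subst (λ j → iter w′ j x ≈𝔥 iter w′ m x) (≡.sym k%3≡m%3) (≈𝔥-sym (iter-%3 w′³≈id m x)))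
    where
      k%3≡m%3 : k % 3 ≡ m % 3
      k%3≡m%3 = ^-injective-<3 (m%n<n k 3) (m%n<n m 3)
                  (ℛ.trans (ℛ.sym (^-%3 ζ-cube k)) (ℛ.trans ζᵏ≈ζᵐ (^-%3 ζ-cube m)))

lemma3p4 : ∀ {c ℓ h ℓh} (S : Setting c ℓ h ℓh) → let open Construction S in
    (∀ x y → x ≈𝔥 y → w′ x ≈𝔥 w′ y)
    × (∀ x y → ⟦ w′ x , w′ y ⟧ ≈𝔥 w′ ⟦ x , y ⟧)
    × (∀ (k m : ℕ) x → ζ ^ k ≈R ζ ^ m → iter w′ k x ≈𝔥 iter w′ m x)
lemma3p4 S = w′-cong , ⟦⟧-w′ , ζ^≈⇒iter-w′≈
  where open W′-Automorphism S
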